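{- Let $G$ be an abelian group with $G\cong\mathbb{Z}_{p^{t_1}}\times\mathbb{Z}_{p^{t_2}}\times\cdots\times\mathbb{Z}_{p^{t_r}}\times\mathbb{Z}_n$, where $p$ is a prime, $r\ge 2$, $t_1,\dots,t_r$ are positive integers, $n\in\mathbb{N}$ and $\gcd(p,n)=1$. Then the number of connected components of $\mathcal{G}^{**}_e(G)$ is $\frac{p^r-1}{p-1}$.
   Context: For a finite group $G$, the enhanced power graph $\mathcal{G}_e(G)$ is the simple graph with vertex set $G$ in which two distinct vertices $u,v$ are adjacent if and only if there exists $w\in G$ such that both $u$ and $v$ are powers of $w$. A dominating vertex is a vertex adjacent to every other vertex. $\mathcal{G}^{**}_e(G)$ is the induced subgraph of $\mathcal{G}_e(G)$ obtained by deleting all dominating vertices. -}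

module Defs where

open import Data.Nat using (ℕ; zero; suc; _+_; _*_; _∸_; _^_; NonZero)
open import Data.Nat.DivMod using (_mod_)
open import Data.Nat.Primality using (Prime; prime⇒nonTrivial)
open import Data.Fin using (Fin; toℕ)
open import Data.List using (List; []; _∷_; map; _++_)
open import Data.Vec using (Vec; toList)
open import Data.Unit using (⊤; tt)
open import Data.Product using (_×_; _,_; Σ; ∃; ∃-syntax)
open import Relation.Nullary using (¬_)
open import Relation.Binary.PropositionalEquality using (_≡_; _≢_)

-- Elements of the finite abelian group  Z_{m₁} × Z_{m₂} × ⋯ × Z_{m_k}
-- (written additively), for a list of moduli ms = m₁ ∷ ⋯ ∷ m_k.
Elem : List ℕ → Set
Elem []       = ⊤
Elem (m ∷ ms) = Fin m × Elem ms

-- k-th multiple (= k-th power in multiplicative notation) in Z_m.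
mulFin : ∀ {m} → ℕ → Fin m → Fin m
mulFin {suc m} k a = (k * toℕ a) mod (suc m)

pow : ∀ {ms} → Elem ms → ℕ → Elem ms
pow {[]}     tt       k = tt
pow {m ∷ ms} (a , as) k = (mulFin k a , pow as k)

moduli : (p : ℕ) {r : ℕ} → Vec ℕ r → ℕ → List ℕ
moduli p ts n = map (λ t → p ^ t) (toList ts) ++ (n ∷ [])

module EnhancedPowerGraph (ms : List ℕ) where
  G : Set
  G = Elem ms

  Adj : G → G → Set
  Adj u v = u ≢ v × (∃[ w ] (∃[ k ] u ≡ pow w k) × (∃[ l ] v ≡ pow w l))

  Dominating : G → Set
  Dominating x = ∀ y → y ≢ x → Adj x y

  Vertex : G → Set
  Vertex x = ¬ Dominating x

  -- Connected u v : there is a path from u to v in G**_e(G), i.e. all of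
  -- whose vertices are non-dominating (u itself is assumed a vertex where used).
  data Connected (u : G) : G → Set where
    here : Connected u u
    step : ∀ {v w} → Connected u v → Vertex w → Adj v w → Connected u w

  HasComponents : ℕ → Set
  HasComponents k =
    Σ (Fin k → G) λ rep →
      (∀ i → Vertex (rep i)) ×
      (∀ i j → Connected (rep i) (rep j) → i ≡ j) ×
      (∀ x → Vertex x → ∃[ i ] Connected x (rep i))

prime⇒pred≢0 : ∀ {p} → Prime p → NonZero (p ∸ 1)
prime⇒pred≢0 {suc (suc k)} _ = _
prime⇒pred≢0 {zero} pp with prime⇒nonTrivial pp
... | ()
prime⇒pred≢0 {suc zero} pp with prime⇒nonTrivial pp
... | ()

module Submission where

-- For a prime P, r ≥ 2, exponents tᵢ ≥ 1 and N coprime to P, the graph G**_e(G) of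
-- G = Z_{P^t₁} × ⋯ × Z_{P^t_r} × Z_N has (P^r − 1)/(P − 1) components, one for
-- each subgroup of order P.  Write elements as (P-part, N-part).
-- (1) x is dominating iff its P-part is 0 (by CRT, x and any y are then powers of
--     (P-part of y, 1)).
-- (2) Key fact: in a cyclic P-group, the elements of order P lie in every nonzero
--     subgroup.  So along an edge u—w of G**_e, an element of order P of
--     ⟨P-part of u⟩ stays in ⟨P-part of w⟩: it is an invariant of the component.
-- (3) The elements of order P form F_P^r.  Normalised vectors enumerate the points
--     of P^(r-1)(F_P) and give one representative per component; every vertex x is
--     joined to (y, 0) with y ∈ ⟨P-part of x⟩ of order P, which lies in the cyclic
--     group of the representative of its line.  (4) There are 1 + P + ⋯ + P^(r-1) points.

open import Defs
open import Data.Nat using (ℕ; _∸_; _^_; _/_; _≤_)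
open import Data.Nat.GCD using (gcd)
open import Data.Nat.Primality using (Prime)
open import Data.Vec using (Vec; lookup)
open import Data.Fin using (Fin)
open import Relation.Binary.PropositionalEquality using (_≡_)

open import Data.Nat using (zero; suc; pred; _+_; _*_; _<_; NonZero; s≤s; z≤n; ≢-nonZero; nonTrivial⇒n>1; _≟_)
open import Data.Nat.Properties
open import Data.Nat.Induction using (<-rec)
open import Data.Nat.DivMod
open import Data.Nat.Divisibility using (_∣_; divides; _∣?_; ∣-refl; ∣-trans; ∣1⇒≡1; n∣m*n; ∣m⇒∣m*n; m%n≡0⇒n∣m)
open import Data.Nat.Coprimality using (Coprime; coprime-Bézout; coprime-divisor; gcd≡1⇒coprime) renaming (sym to coprime-sym)
open import Data.Nat.GCD using (module Bézout)
open import Data.Nat.Primality using (prime⇒irreducible; prime⇒nonZero; prime⇒nonTrivial)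
open import Data.Nat.Tactic.RingSolver using (solve-∀)
open import Data.Fin using (toℕ; fromℕ<; remQuot; combine; splitAt; _↑ˡ_; _↑ʳ_) renaming (zero to fzero; suc to fsuc)
open import Data.Fin.Properties using (toℕ-fromℕ<; toℕ-injective; toℕ<n; remQuot-combine; combine-remQuot; splitAt-↑ˡ; splitAt-↑ʳ; splitAt⁻¹-↑ˡ; splitAt⁻¹-↑ʳ) renaming (_≟_ to _≟F_)
open import Data.Vec using ([]; _∷_; replicate; map; toList)
open import Data.List using (List; []; _∷_; _++_) renaming (map to mapₗ)
open import Data.List.Relation.Unary.All using (All; []; _∷_)
import Data.List.Relation.Unary.All as All
open import Data.Unit using (⊤; tt)
open import Data.Product using (_×_; _,_; ∃-syntax; proj₁; proj₂)
open import Data.Sum using (inj₁; inj₂)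
open import Data.Empty using (⊥-elim)
open import Relation.Nullary using (¬_; yes; no; Dec)
open import Relation.Binary.PropositionalEquality using (refl; sym; trans; cong; cong₂; subst; subst₂; module ≡-Reasoning; _≢_)

toℕ-mulFin : ∀ {m} .{{_ : NonZero m}} k (a : Fin m) → toℕ (mulFin k a) ≡ (k * toℕ a) % m
toℕ-mulFin {suc m} k a = toℕ-fromℕ< _

mulFin-identity : ∀ {m} (a : Fin m) → mulFin 1 a ≡ a
mulFin-identity {suc m} a = toℕ-injective (begin
  toℕ (mulFin 1 a)     ≡⟨ toℕ-mulFin 1 a ⟩
  (1 * toℕ a) % suc m  ≡⟨ cong (_% suc m) (*-identityˡ (toℕ a)) ⟩
  toℕ a % suc m        ≡⟨ m<n⇒m%n≡m (toℕ<n a) ⟩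
  toℕ a                ∎)
  where open ≡-Reasoning

mulFin-mulFin : ∀ {m} (a : Fin m) (k l : ℕ) → mulFin l (mulFin k a) ≡ mulFin (l * k) a
mulFin-mulFin {suc m} a k l = toℕ-injective (begin
  toℕ (mulFin l (mulFin k a))          ≡⟨ toℕ-mulFin l _ ⟩
  (l * toℕ (mulFin k a)) % suc m       ≡⟨ cong (λ v → (l * v) % suc m) (toℕ-mulFin k a) ⟩
  (l * ((k * toℕ a) % suc m)) % suc m  ≡⟨ %-distribˡ-* l _ (suc m) ⟩
  (l % suc m * ((k * toℕ a) % suc m % suc m)) % suc m
                                        ≡⟨ cong (λ v → (l % suc m * v) % suc m) (m%n%n≡m%n (k * toℕ a) (suc m)) ⟩
  (l % suc m * ((k * toℕ a) % suc m)) % suc m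
                                        ≡⟨ %-distribˡ-* l (k * toℕ a) (suc m) ⟨
  (l * (k * toℕ a)) % suc m            ≡⟨ cong (_% suc m) (*-assoc l k (toℕ a)) ⟨
  ((l * k) * toℕ a) % suc m            ≡⟨ toℕ-mulFin (l * k) a ⟨
  toℕ (mulFin (l * k) a)               ∎)
  where open ≡-Reasoning

mulFin-zero : ∀ {m} (a b : Fin m) → mulFin 0 a ≡ mulFin 0 b
mulFin-zero {suc m} a b = refl

mulFin-periodic : ∀ {m} M → m ∣ M → (a : Fin m) (k q : ℕ) → mulFin (k + q * M) a ≡ mulFin k a
mulFin-periodic {suc m} M m∣M a k q = toℕ-injective (begin
  toℕ (mulFin (k + q * M) a)                ≡⟨ toℕ-mulFin (k + q * M) a ⟩
  ((k + q * M) * toℕ a) % suc m             ≡⟨ cong (_% suc m) (*-distribʳ-+ (toℕ a) k (q * M)) ⟩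
  (k * toℕ a + q * M * toℕ a) % suc m       ≡⟨ %-remove-+ʳ (k * toℕ a) (∣m⇒∣m*n (toℕ a) (∣-trans m∣M (n∣m*n q))) ⟩
  (k * toℕ a) % suc m                       ≡⟨ toℕ-mulFin k a ⟨
  toℕ (mulFin k a)                          ∎)
  where open ≡-Reasoning

pow-identity : ∀ {ms} (x : Elem ms) → pow x 1 ≡ x
pow-identity {[]}     tt       = refl
pow-identity {m ∷ ms} (a , as) = cong₂ _,_ (mulFin-identity a) (pow-identity as)

pow-pow : ∀ {ms} (x : Elem ms) (k l : ℕ) → pow (pow x k) l ≡ pow x (l * k)
pow-pow {[]}     tt       k l = refl
pow-pow {m ∷ ms} (a , as) k l = cong₂ _,_ (mulFin-mulFin a k l) (pow-pow as k l)

pow-zero : ∀ {ms} (x y : Elem ms) → pow x 0 ≡ pow y 0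
pow-zero {[]}     tt       tt       = refl
pow-zero {m ∷ ms} (a , as) (b , bs) = cong₂ _,_ (mulFin-zero a b) (pow-zero as bs)

pow-periodic : ∀ {ms} M → All (_∣ M) ms → (x : Elem ms) (k q : ℕ) → pow x (k + q * M) ≡ pow x k
pow-periodic {[]}     M []       tt       k q = refl
pow-periodic {m ∷ ms} M (d ∷ ds) (a , as) k q = cong₂ _,_ (mulFin-periodic M d a k q) (pow-periodic M ds as k q)

_≟E_ : ∀ {ms} (x y : Elem ms) → Dec (x ≡ y)
_≟E_ {[]}     tt      tt      = yes refl
_≟E_ {m ∷ ms} (a , x) (b , y) with a ≟F b | x ≟E y
... | yes refl | yes refl = yes refl
... | no a≢b   | _        = no (λ e → a≢b (cong proj₁ e))
... | yes _    | no x≢y   = no (λ e → x≢y (cong proj₂ e))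

-- x is the neutral element ("zero", in additive notation) of its group.
IsZero : ∀ {ms} → Elem ms → Set
IsZero x = x ≡ pow x 0

zero-isZero : ∀ {ms} (x : Elem ms) → IsZero (pow x 0)
zero-isZero x = pow-zero x (pow x 0)

pow-isZero : ∀ {ms} (x : Elem ms) (k : ℕ) → IsZero x → IsZero (pow x k)
pow-isZero x k x≡0 = begin
  pow x k           ≡⟨ cong (λ v → pow v k) x≡0 ⟩
  pow (pow x 0) k   ≡⟨ pow-pow x 0 k ⟩
  pow x (k * 0)     ≡⟨ cong (pow x) (*-zeroʳ k) ⟩
  pow x 0           ≡⟨ pow-zero x (pow x k) ⟩
  pow (pow x k) 0   ∎
  where open ≡-Reasoning

infix 4 _∈⟨_⟩
_∈⟨_⟩ : ∀ {ms} → Elem ms → Elem ms → Set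
y ∈⟨ g ⟩ = ∃[ k ] y ≡ pow g k

∈⟨⟩-refl : ∀ {ms} (g : Elem ms) → g ∈⟨ g ⟩
∈⟨⟩-refl g = 1 , sym (pow-identity g)

∈⟨⟩-trans : ∀ {ms} {x y g : Elem ms} → x ∈⟨ y ⟩ → y ∈⟨ g ⟩ → x ∈⟨ g ⟩
∈⟨⟩-trans {g = g} (k , refl) (l , refl) = k * l , pow-pow g l k

fstE : ∀ xs {ys} → Elem (xs ++ ys) → Elem xs
fstE []       e       = tt
fstE (m ∷ xs) (a , e) = a , fstE xs e

sndE : ∀ xs {ys} → Elem (xs ++ ys) → Elem ys
sndE []       e       = e
sndE (m ∷ xs) (a , e) = sndE xs e

joinE : ∀ xs {ys} → Elem xs → Elem ys → Elem (xs ++ ys)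
joinE []       tt      v = v
joinE (m ∷ xs) (a , u) v = a , joinE xs u v

fstE-pow : ∀ xs {ys} (e : Elem (xs ++ ys)) k → fstE xs (pow e k) ≡ pow (fstE xs e) k
fstE-pow []       e       k = refl
fstE-pow (m ∷ xs) (a , e) k = cong (mulFin k a ,_) (fstE-pow xs e k)

sndE-pow : ∀ xs {ys} (e : Elem (xs ++ ys)) k → sndE xs (pow e k) ≡ pow (sndE xs e) k
sndE-pow []       e       k = refl
sndE-pow (m ∷ xs) (a , e) k = sndE-pow xs e k

fstE-join : ∀ xs {ys} (u : Elem xs) (v : Elem ys) → fstE xs (joinE xs u v) ≡ u
fstE-join []       tt      v = refl
fstE-join (m ∷ xs) (a , u) v = cong (a ,_) (fstE-join xs u v)

sndE-join : ∀ xs {ys} (u : Elem xs) (v : Elem ys) → sndE xs (joinE xs u v) ≡ v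
sndE-join []       tt      v = refl
sndE-join (m ∷ xs) (a , u) v = sndE-join xs u v

joinE-split : ∀ xs {ys} (e : Elem (xs ++ ys)) → joinE xs (fstE xs e) (sndE xs e) ≡ e
joinE-split []       e       = refl
joinE-split (m ∷ xs) (a , e) = cong (a ,_) (joinE-split xs e)

Elem-ext : ∀ xs {ys} (e f : Elem (xs ++ ys)) → fstE xs e ≡ fstE xs f → sndE xs e ≡ sndE xs f → e ≡ f
Elem-ext xs e f p q = trans (sym (joinE-split xs e)) (trans (cong₂ (joinE xs) p q) (joinE-split xs f))

coprime-* : ∀ {m n a} → Coprime m a → Coprime n a → Coprime (m * n) a
coprime-* {m} {n} {a} m⊥a n⊥a {i} (i∣mn , i∣a) = n⊥a (coprime-divisor i⊥m i∣mn , i∣a)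
  where
  i⊥m : Coprime i m
  i⊥m (j∣i , j∣m) = m⊥a (j∣m , ∣-trans j∣i i∣a)

coprime-^ : ∀ {m a} k → Coprime m a → Coprime (m ^ k) a
coprime-^ zero    m⊥a (i∣1 , _) = ∣1⇒≡1 i∣1
coprime-^ (suc k) m⊥a = coprime-* m⊥a (coprime-^ k m⊥a)

prime∤⇒coprime : ∀ {p a} → Prime p → ¬ (p ∣ a) → Coprime p a
prime∤⇒coprime pp p∤a {i} (i∣p , i∣a) with prime⇒irreducible pp i∣p
... | inj₁ i≡1    = i≡1
... | inj₂ refl   = ⊥-elim (p∤a i∣a)

invertible-mod : ∀ a b .{{_ : NonZero a}} .{{_ : NonZero b}} → Coprime a b → ∃[ u ] ∃[ v ] a * u ≡ 1 + b * v
invertible-mod a@(suc a') b@(suc b') a⊥b with coprime-Bézout a⊥b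
... | Bézout.+- x y eq = x , y , trans (*-comm a x) (trans (sym eq) (cong suc (*-comm y b)))
... | Bézout.-+ x y eq = b + n * x , n * y , (begin
  a * (b + n * x)      ≡⟨ expand a' b' x ⟩
  1 + n * (1 + x * a)  ≡⟨ cong (λ z → 1 + n * z) eq ⟩
  1 + n * (y * b)      ≡⟨ regroup n y b ⟩
  1 + b * (n * y)      ∎)
  where
  open ≡-Reasoning
  -- n = a·b − 1
  n : ℕ
  n = b' + a' * b
  expand : ∀ a' b' x → suc a' * (suc b' + (b' + a' * suc b') * x) ≡ 1 + (b' + a' * suc b') * (1 + x * suc a')
  expand = solve-∀
  regroup : ∀ n y b → 1 + n * (y * b) ≡ 1 + b * (n * y)
  regroup = solve-∀

crt : ∀ M N .{{_ : NonZero M}} .{{_ : NonZero N}} → Coprime M N → ∀ a b →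
      ∃[ k ] ∃[ q₁ ] ∃[ q₂ ] (k ≡ a + q₁ * M) × (k ≡ b + q₂ * N)
crt M N M⊥N a b with invertible-mod M N M⊥N | invertible-mod N M (coprime-sym M⊥N)
... | u , v , Mu≡1+Nv | u' , v' , Nu'≡1+Mv' =
  a * (N * u') + b * (M * u) , a * v' + b * u , a * u' + b * v ,
  trans (cong (λ z → a * z + b * (M * u)) Nu'≡1+Mv') (≡a a b M u v') ,
  trans (cong (λ z → a * (N * u') + b * z) Mu≡1+Nv) (≡b a b N u' v)
  where
  ≡a : ∀ a b M u v' → a * (1 + M * v') + b * (M * u) ≡ a + (a * v' + b * u) * M
  ≡a = solve-∀
  ≡b : ∀ a b N u' v → a * (N * u') + b * (1 + N * v) ≡ b + (a * u' + b * v) * N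
  ≡b = solve-∀

factor-power : ∀ P → 2 ≤ P → ∀ l → l ≢ 0 → ∃[ s ] ∃[ l' ] (l ≡ P ^ s * l') × ¬ (P ∣ l')
factor-power P 2≤P = <-rec _ step
  where
  step : ∀ l → (∀ {q} → q < l → q ≢ 0 → ∃[ s ] ∃[ l' ] (q ≡ P ^ s * l') × ¬ (P ∣ l')) →
         l ≢ 0 → ∃[ s ] ∃[ l' ] (l ≡ P ^ s * l') × ¬ (P ∣ l')
  step l rec l≢0 with P ∣? l
  ... | no P∤l = 0 , l , sym (+-identityʳ l) , P∤l
  ... | yes (divides q refl) with rec (m<m*n q P {{≢-nonZero q≢0}} 2≤P) q≢0
    where
    q≢0 : q ≢ 0
    q≢0 refl = l≢0 refl
  ...   | s , l' , refl , P∤l' = suc s , l' , regroup P (P ^ s) l' , P∤l'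
    where
    regroup : ∀ P A l' → A * l' * P ≡ P * A * l'
    regroup = solve-∀

module PGroup {P : ℕ} (prime : Prime P) (T : ℕ) (ms : List ℕ) (exponent : All (_∣ P ^ T) ms) where

  instance
    P-nonZero : NonZero P
    P-nonZero = prime⇒nonZero prime

    Pᵀ-nonZero : NonZero (P ^ T)
    Pᵀ-nonZero = m^n≢0 P T

  2≤P : 2 ≤ P
  2≤P = nonTrivial⇒n>1 P {{prime⇒nonTrivial prime}}

  E : Set
  E = Elem ms

  cancel-unit : (g : E) (A c : ℕ) → ¬ (P ∣ c) → pow g A ∈⟨ pow g (A * c) ⟩
  cancel-unit g A zero    P∤0 = ⊥-elim (P∤0 (divides 0 refl))
  cancel-unit g A c@(suc _) P∤c
    with invertible-mod c (P ^ T) (coprime-sym (coprime-^ T (prime∤⇒coprime prime P∤c)))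
  ... | u , v , cu≡1+Mv = u , sym (begin
    pow (pow g (A * c)) u        ≡⟨ pow-pow g (A * c) u ⟩
    pow g (u * (A * c))          ≡⟨ cong (pow g) (regroup u A c) ⟩
    pow g (A * (c * u))          ≡⟨ cong (λ z → pow g (A * z)) cu≡1+Mv ⟩
    pow g (A * (1 + P ^ T * v))  ≡⟨ cong (pow g) (expand A (P ^ T) v) ⟩
    pow g (A + A * v * P ^ T)    ≡⟨ pow-periodic (P ^ T) exponent g A (A * v) ⟩
    pow g A                      ∎)
    where
    open ≡-Reasoning
    regroup : ∀ u A c → u * (A * c) ≡ A * (c * u)
    regroup = solve-∀
    expand : ∀ A M v → A * (1 + M * v) ≡ A + A * v * M
    expand = solve-∀

  power-of-smaller : (g : E) {s a : ℕ} (m : ℕ) → s ≤ a → pow g (P ^ a * m) ≡ pow (pow g (P ^ s)) (P ^ (a ∸ s) * m)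
  power-of-smaller g {s} {a} m s≤a = begin
    pow g (P ^ a * m)                ≡⟨ cong (λ z → pow g (P ^ z * m)) (m+[n∸m]≡n s≤a) ⟨
    pow g (P ^ (s + d) * m)          ≡⟨ cong (λ z → pow g (z * m)) (^-distribˡ-+-* P s d) ⟩
    pow g (P ^ s * P ^ d * m)        ≡⟨ cong (pow g) (regroup (P ^ s) (P ^ d) m) ⟩
    pow g (P ^ d * m * P ^ s)        ≡⟨ pow-pow g (P ^ s) (P ^ d * m) ⟨
    pow (pow g (P ^ s)) (P ^ d * m)  ∎
    where
    open ≡-Reasoning
    d : ℕ
    d = a ∸ s
    regroup : ∀ A B m → A * B * m ≡ B * m * A
    regroup = solve-∀

  order-P⇒next-zero : (g : E) (a m : ℕ) → ¬ (P ∣ m) → IsZero (pow (pow g (P ^ a * m)) P) →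
                      IsZero (pow g (P ^ suc a))
  order-P⇒next-zero g a m P∤m yᴾ≡0 with cancel-unit g (P ^ suc a) m P∤m
  ... | u , eq = subst IsZero (sym eq) (pow-isZero _ u (subst IsZero yᴾ≡g^A yᴾ≡0))
    where
    yᴾ≡g^A : pow (pow g (P ^ a * m)) P ≡ pow g (P ^ suc a * m)
    yᴾ≡g^A = trans (pow-pow g (P ^ a * m) P) (cong (pow g) (sym (*-assoc P (P ^ a) m)))

  nonzero-exponent : (g : E) (k : ℕ) → ¬ IsZero (pow g k) → k ≢ 0
  nonzero-exponent g k gᵏ≢0 refl = gᵏ≢0 (zero-isZero g)

  -- Write y = g^(P^a·m'), z = g^(P^s·l') with P ∤ m', l'.
  -- Then ⟨z⟩ = ⟨g^(P^s)⟩; if s ≤ a this contains y, and if s > a then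
  -- z ∈ ⟨g^(P^(a+1))⟩ = 0, since y has order P.
  order-P-in-every-subgroup : {g y z : E} → y ∈⟨ g ⟩ → z ∈⟨ g ⟩ →
                              IsZero (pow y P) → ¬ IsZero y → ¬ IsZero z → y ∈⟨ z ⟩
  order-P-in-every-subgroup {g} (m , refl) (l , refl) yᴾ≡0 y≢0 z≢0
    with factor-power P 2≤P m (nonzero-exponent g m y≢0) | factor-power P 2≤P l (nonzero-exponent g l z≢0)
  ... | a , m' , refl , P∤m' | s , l' , refl , P∤l' with cancel-unit g (P ^ s) l' P∤l' | s ≤? a
  ...   | u , g^Pˢ≡zᵘ | yes s≤a = P ^ (a ∸ s) * m' * u , (begin
    pow g (P ^ a * m')                      ≡⟨ power-of-smaller g m' s≤a ⟩
    pow (pow g (P ^ s)) (P ^ (a ∸ s) * m')  ≡⟨ cong (λ z → pow z (P ^ (a ∸ s) * m')) g^Pˢ≡zᵘ ⟩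
    pow (pow z u) (P ^ (a ∸ s) * m')        ≡⟨ pow-pow z u (P ^ (a ∸ s) * m') ⟩
    pow z (P ^ (a ∸ s) * m' * u)            ∎)
    where
    open ≡-Reasoning
    z : E
    z = pow g (P ^ s * l')
  ...   | _ | no s≰a = ⊥-elim (z≢0 (subst IsZero (sym (power-of-smaller g l' (≰⇒> s≰a)))
                                    (pow-isZero _ _ (order-P⇒next-zero g a m' P∤m' yᴾ≡0))))

  -- Every nonzero element has a power of order P: the last nonzero one among
  -- v, v^P, v^(P²), …, v^(P^T) = 0.
  order-P-power : (v : E) → ¬ IsZero v → ∃[ y ] y ∈⟨ v ⟩ × ¬ IsZero y × IsZero (pow y P)
  order-P-power v v≢0 = search T (subst (λ z → ¬ IsZero z) (sym (pow-identity v)) v≢0) v^Pᵀ≡0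
    where
    v^Pᵀ≡0 : IsZero (pow v (P ^ T))
    v^Pᵀ≡0 = subst IsZero (sym (trans (cong (pow v) (sym (*-identityˡ (P ^ T)))) (pow-periodic (P ^ T) exponent v 0 1)))
               (zero-isZero v)
    search : ∀ K → ¬ IsZero (pow v (P ^ 0)) → IsZero (pow v (P ^ K)) →
             ∃[ y ] y ∈⟨ v ⟩ × ¬ IsZero y × IsZero (pow y P)
    search zero    v≢0 v≡0 = ⊥-elim (v≢0 v≡0)
    search (suc K) v≢0 vᴷ⁺¹≡0 with pow v (P ^ K) ≟E pow (pow v (P ^ K)) 0
    ... | yes vᴷ≡0 = search K v≢0 vᴷ≡0
    ... | no vᴷ≢0  = pow v (P ^ K) , (P ^ K , refl) , vᴷ≢0 , subst IsZero (sym (pow-pow v (P ^ K) P)) vᴷ⁺¹≡0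

-- Vectors of naturals read modulo a prime P, i.e. vectors over F_P, and an
-- enumeration of the points of the projective space P^(r-1)(F_P): every nonzero
-- vector is a multiple of exactly one normalised vector (first nonzero entry 1).
module ProjectiveSpace (p' : ℕ) (prime : Prime (suc (suc p'))) where

  P : ℕ
  P = suc (suc p')

  infix 4 _≈_
  _≈_ : ∀ {r} → Vec ℕ r → Vec ℕ r → Set
  []       ≈ []         = ⊤
  (k ∷ ks) ≈ (k' ∷ ks') = (k % P ≡ k' % P) × (ks ≈ ks')

  ≈-sym : ∀ {r} {v w : Vec ℕ r} → v ≈ w → w ≈ v
  ≈-sym {v = []}    {[]}    _       = tt
  ≈-sym {v = _ ∷ _} {_ ∷ _} (e , h) = sym e , ≈-sym h

  ≈-trans : ∀ {r} {u v w : Vec ℕ r} → u ≈ v → v ≈ w → u ≈ w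
  ≈-trans {u = []}    {[]}    {[]}    _       _         = tt
  ≈-trans {u = _ ∷ _} {_ ∷ _} {_ ∷ _} (e , h) (e' , h') = trans e e' , ≈-trans h h'

  zeros : ∀ r → Vec ℕ r
  zeros r = replicate r 0

  scale : ∀ {r} → ℕ → Vec ℕ r → Vec ℕ r
  scale c = map (c *_)

  *-congʳ-mod : ∀ c {a b} → a % P ≡ b % P → (c * a) % P ≡ (c * b) % P
  *-congʳ-mod c {a} {b} e =
    trans (%-distribˡ-* c a P) (trans (cong (λ z → ((c % P) * z) % P) e) (sym (%-distribˡ-* c b P)))

  *-congˡ-mod : ∀ c d a → c % P ≡ d % P → (c * a) % P ≡ (d * a) % P
  *-congˡ-mod c d a e = trans (cong (_% P) (*-comm c a)) (trans (*-congʳ-mod a e) (cong (_% P) (*-comm a d)))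

  scale-cong : ∀ {r} c {v w : Vec ℕ r} → v ≈ w → scale c v ≈ scale c w
  scale-cong c {[]}    {[]}    _       = tt
  scale-cong c {_ ∷ _} {_ ∷ _} (e , h) = *-congʳ-mod c e , scale-cong c h

  scale-one : ∀ {r} c (v : Vec ℕ r) → c % P ≡ 1 % P → scale c v ≈ v
  scale-one c []      e = tt
  scale-one c (k ∷ v) e = trans (*-congˡ-mod c 1 k e) (cong (_% P) (*-identityˡ k)) , scale-one c v e

  scale-zero : ∀ {r} c (v : Vec ℕ r) → c % P ≡ 0 % P → scale c v ≈ zeros r
  scale-zero c []      e = tt
  scale-zero c (k ∷ v) e = *-congˡ-mod c 0 k e , scale-zero c v e

  scale-scale : ∀ {r} c u (v : Vec ℕ r) → scale c (scale u v) ≈ scale (c * u) v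
  scale-scale c u []      = tt
  scale-scale c u (k ∷ v) = cong (_% P) (sym (*-assoc c u k)) , scale-scale c u v

  -- Base-P digits identify Fin (P^r) with F_P^r.
  digits : ∀ r → Fin (P ^ r) → Vec ℕ r
  digits zero    _ = []
  digits (suc r) a = toℕ (proj₁ (remQuot {P} (P ^ r) a)) ∷ digits r (proj₂ (remQuot {P} (P ^ r) a))

  digits-injective : ∀ r (a a' : Fin (P ^ r)) → digits r a ≈ digits r a' → a ≡ a'
  digits-injective zero    fzero fzero _       = refl
  digits-injective (suc r) a     a'    (e , h) = begin
    a                                ≡⟨ combine-remQuot {P} (P ^ r) a ⟨
    combine (proj₁ (q a)) (proj₂ (q a))
      ≡⟨ cong₂ combine (toℕ-injective (digit-eq (proj₁ (q a)) (proj₁ (q a')) e))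
                       (digits-injective r (proj₂ (q a)) (proj₂ (q a')) h) ⟩
    combine (proj₁ (q a')) (proj₂ (q a')) ≡⟨ combine-remQuot {P} (P ^ r) a' ⟩
    a'                               ∎
    where
    open ≡-Reasoning
    q : Fin (P ^ suc r) → Fin P × Fin (P ^ r)
    q = remQuot {P} (P ^ r)
    digit-eq : (d d' : Fin P) → toℕ d % P ≡ toℕ d' % P → toℕ d ≡ toℕ d'
    digit-eq d d' e = trans (sym (m<n⇒m%n≡m (toℕ<n d))) (trans e (m<n⇒m%n≡m (toℕ<n d')))

  digits-surjective : ∀ r (ks : Vec ℕ r) → ∃[ a ] digits r a ≈ ks
  digits-surjective zero    []       = fzero , tt
  digits-surjective (suc r) (k ∷ ks) with digits-surjective r ks
  ... | a , h = combine d a , first , subst (λ z → digits r z ≈ ks) (sym (cong proj₂ split)) h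
    where
    d : Fin P
    d = fromℕ< (m%n<n k P)
    split : remQuot {P} (P ^ r) (combine d a) ≡ (d , a)
    split = remQuot-combine {P} {P ^ r} d a
    first : toℕ (proj₁ (remQuot {P} (P ^ r) (combine d a))) % P ≡ k % P
    first = trans (cong (λ z → toℕ (proj₁ z) % P) split) (trans (m<n⇒m%n≡m (toℕ<n d)) (toℕ-fromℕ< _))

  -- Number of points of P^(r-1)(F_P): P^(r-1) + ⋯ + P + 1.
  #points : ℕ → ℕ
  #points zero    = 0
  #points (suc r) = P ^ r + #points r

  -- The normalised representative of each point: either 1 followed by an
  -- arbitrary vector, or 0 followed by a point of the smaller space.
  point : ∀ r → Fin (#points r) → Vec ℕ r
  point (suc r) i with splitAt (P ^ r) i
  ... | inj₁ a = 1 ∷ digits r a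
  ... | inj₂ b = 0 ∷ point r b

  point-↑ˡ : ∀ r a → point (suc r) (a ↑ˡ #points r) ≡ 1 ∷ digits r a
  point-↑ˡ r a rewrite splitAt-↑ˡ (P ^ r) a (#points r) = refl

  point-↑ʳ : ∀ r b → point (suc r) (P ^ r ↑ʳ b) ≡ 0 ∷ point r b
  point-↑ʳ r b rewrite splitAt-↑ʳ (P ^ r) (#points r) b = refl

  -- Points are nonzero vectors (their first nonzero entry is 1 ≢ 0 mod P).
  1≢0-mod : ¬ (1 % P ≡ 0 % P)
  1≢0-mod ()

  point-nonzero : ∀ r i → ¬ (point r i ≈ zeros r)
  point-nonzero (suc r) i h with splitAt (P ^ r) i
  point-nonzero (suc r) i (e , h) | inj₁ a = 1≢0-mod e
  point-nonzero (suc r) i (e , h) | inj₂ b = point-nonzero r b h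

  point-unique : ∀ r c i j → scale c (point r i) ≈ point r j → i ≡ j
  point-unique (suc r) c i j h with splitAt (P ^ r) i in ei | splitAt (P ^ r) j in ej
  point-unique (suc r) c i j (e , h) | inj₁ a | inj₁ a' =
    trans (sym (splitAt⁻¹-↑ˡ ei)) (trans (cong (_↑ˡ #points r) a≡a') (splitAt⁻¹-↑ˡ ej))
    where
    c≡1 : c % P ≡ 1 % P
    c≡1 = trans (cong (_% P) (sym (*-identityʳ c))) e
    a≡a' : a ≡ a'
    a≡a' = digits-injective r a a' (≈-trans (≈-sym (scale-one c (digits r a) c≡1)) h)
  point-unique (suc r) c i j (e , h) | inj₁ a | inj₂ b =
    ⊥-elim (point-nonzero r b (≈-trans (≈-sym h) (scale-zero c (digits r a) (trans (cong (_% P) (sym (*-identityʳ c))) e))))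
  point-unique (suc r) c i j (e , h) | inj₂ b | inj₁ a =
    ⊥-elim (1≢0-mod (trans (sym e) (cong (_% P) (*-zeroʳ c))))
  point-unique (suc r) c i j (e , h) | inj₂ b | inj₂ b' =
    trans (sym (splitAt⁻¹-↑ʳ ei)) (trans (cong (P ^ r ↑ʳ_) (point-unique r c b b' h)) (splitAt⁻¹-↑ʳ ej))

  on-some-point : ∀ r (ks : Vec ℕ r) → ¬ (ks ≈ zeros r) → ∃[ i ] ∃[ c ] ks ≈ scale c (point r i)
  on-some-point zero    []       ks≢0 = ⊥-elim (ks≢0 tt)
  on-some-point (suc r) (k ∷ ks) ks≢0 with k % P ≟ 0
  ... | yes k≡0 with on-some-point r ks (λ z → ks≢0 (k≡0 , z))
  ...   | i , c , h = P ^ r ↑ʳ i , c ,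
          subst (λ z → (k ∷ ks) ≈ scale c z) (sym (point-↑ʳ r i)) (trans k≡0 (cong (_% P) (sym (*-zeroʳ c))) , h)
  on-some-point (suc r) (zero ∷ ks)  ks≢0 | no k≢0 = ⊥-elim (k≢0 refl)
  on-some-point (suc r) (suc k ∷ ks) ks≢0 | no k≢0
    with invertible-mod (suc k) P (coprime-sym (prime∤⇒coprime prime P∤k))
    where
    P∤k : ¬ (P ∣ suc k)
    P∤k (divides q eq) = k≢0 (trans (cong (_% P) eq) (m*n%n≡0 q P))
  ... | u , v , ku≡1+Pv with digits-surjective r (scale u ks)
  ...   | a , h = a ↑ˡ #points r , suc k ,
          subst (λ z → (suc k ∷ ks) ≈ scale (suc k) z) (sym (point-↑ˡ r a))
            (cong (_% P) (sym (*-identityʳ (suc k))) ,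
             ≈-sym (≈-trans (scale-cong (suc k) h) (≈-trans (scale-scale (suc k) u ks) (scale-one (suc k * u) ks ku≡1))))
    where
    ku≡1 : (suc k * u) % P ≡ 1 % P
    ku≡1 = trans (cong (_% P) (trans ku≡1+Pv (cong suc (*-comm P v)))) ([m+kn]%n≡m%n 1 v P)

  two-points : ∀ r → 2 ≤ r → 2 ≤ #points r
  two-points (suc (suc r)) (s≤s (s≤s _)) = +-mono-≤ (m^n>0 P (suc r)) (≤-trans (m^n>0 P r) (m≤m+n (P ^ r) (#points r)))

  geometric : ∀ r → P ^ r ≡ 1 + suc p' * #points r
  geometric zero    = cong suc (sym (*-zeroʳ p'))
  geometric (suc r) = sym (begin
    1 + suc p' * (P ^ r + #points r)       ≡⟨ regroup (suc p') (P ^ r) (#points r) ⟩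
    (1 + suc p' * #points r) + suc p' * P ^ r ≡⟨ cong (_+ suc p' * P ^ r) (geometric r) ⟨
    P ^ r + suc p' * P ^ r                 ≡⟨ collect p' (P ^ r) ⟩
    P * P ^ r                              ∎)
    where
    open ≡-Reasoning
    regroup : ∀ s A K → 1 + s * (A + K) ≡ (1 + s * K) + s * A
    regroup = solve-∀
    collect : ∀ p' A → A + suc p' * A ≡ suc (suc p') * A
    collect = solve-∀

  #points-formula : ∀ r → #points r ≡ (P ^ r ∸ 1) / suc p'
  #points-formula r = sym (begin
    (P ^ r ∸ 1) / suc p'                  ≡⟨ cong (λ z → (z ∸ 1) / suc p') (geometric r) ⟩
    (suc p' * #points r) / suc p'         ≡⟨ cong (_/ suc p') (*-comm (suc p') (#points r)) ⟩
    (#points r * suc p') / suc p'         ≡⟨ m*n/n≡m (#points r) (suc p') ⟩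
    #points r                             ∎)
    where open ≡-Reasoning

-- The P-part Z_{P^(x₁+1)} × ⋯ × Z_{P^(x_r+1)} of the group, and its socle
-- Ω = {y | y^P = 0}, which is the F_P-vector space F_P^r: every y ∈ Ω is
-- realize s ks = (k₁·P^x₁, …, k_r·P^x_r) for a vector ks determined modulo P.
module Socle (p' : ℕ) (prime : Prime (suc (suc p'))) where
  open ProjectiveSpace p' prime

  instance
    P-nonZero : NonZero P
    P-nonZero = _

  pModuli : ∀ {r} → Vec ℕ r → List ℕ
  pModuli s = mapₗ (P ^_) (toList (map suc s))

  -- Σ (xᵢ + 1): P to this power is a common multiple of the moduli.
  exponentOf : ∀ {r} → Vec ℕ r → ℕ
  exponentOf []      = 0
  exponentOf (x ∷ s) = suc x + exponentOf s

  exponent-divides : ∀ {r} (s : Vec ℕ r) → All (_∣ P ^ exponentOf s) (pModuli s)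
  exponent-divides []      = []
  exponent-divides (x ∷ s) =
    divides (P ^ exponentOf s) (trans split (*-comm (P ^ suc x) _)) ∷ All.map (λ d → ∣-trans d rest∣) (exponent-divides s)
    where
    split : P ^ (suc x + exponentOf s) ≡ P ^ suc x * P ^ exponentOf s
    split = ^-distribˡ-+-* P (suc x) (exponentOf s)
    rest∣ : P ^ exponentOf s ∣ P ^ (suc x + exponentOf s)
    rest∣ = subst (P ^ exponentOf s ∣_) (sym split) (n∣m*n (P ^ suc x))

  -- P^x, the generator of the socle of Z_{P^(x+1)}
  base : ∀ x → Fin (P ^ suc x)
  base x = fromℕ< (subst (P ^ x <_) (*-comm (P ^ x) P) (m<m*n (P ^ x) P {{m^n≢0 P x}} (s≤s (s≤s z≤n))))

  toℕ-mulFin-base : ∀ x k → toℕ (mulFin k (base x)) ≡ (k % P) * P ^ x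
  toℕ-mulFin-base x k = begin
    toℕ (mulFin k (base x))         ≡⟨ toℕ-mulFin {{m^n≢0 P (suc x)}} k (base x) ⟩
    _%_ (k * toℕ (base x)) (P ^ suc x) {{m^n≢0 P (suc x)}}
                                    ≡⟨ cong (λ z → _%_ (k * z) (P ^ suc x) {{m^n≢0 P (suc x)}}) (toℕ-fromℕ< _) ⟩
    _%_ (k * P ^ x) (P * P ^ x) {{m^n≢0 P (suc x)}}
                                    ≡⟨ m%n*o≡m*o%[n*o] k P (P ^ x) {{_}} {{m^n≢0 P (suc x)}} ⟨
    (k % P) * P ^ x                 ∎
    where open ≡-Reasoning

  realize : ∀ {r} (s : Vec ℕ r) → Vec ℕ r → Elem (pModuli s)
  realize []      []       = tt
  realize (x ∷ s) (k ∷ ks) = mulFin k (base x) , realize s ks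

  realize-pow : ∀ {r} (s : Vec ℕ r) ks c → pow (realize s ks) c ≡ realize s (scale c ks)
  realize-pow []      []       c = refl
  realize-pow (x ∷ s) (k ∷ ks) c = cong₂ _,_ (mulFin-mulFin (base x) k c) (realize-pow s ks c)

  realize-cong : ∀ {r} (s : Vec ℕ r) ks ks' → ks ≈ ks' → realize s ks ≡ realize s ks'
  realize-cong []      []       []         _       = refl
  realize-cong (x ∷ s) (k ∷ ks) (k' ∷ ks') (e , h) =
    cong₂ _,_ (toℕ-injective (trans (toℕ-mulFin-base x k) (trans (cong (_* P ^ x) e) (sym (toℕ-mulFin-base x k')))))
              (realize-cong s ks ks' h)

  realize-injective : ∀ {r} (s : Vec ℕ r) ks ks' → realize s ks ≡ realize s ks' → ks ≈ ks'
  realize-injective []      []       []         _ = tt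
  realize-injective (x ∷ s) (k ∷ ks) (k' ∷ ks') e =
    *-cancelʳ-≡ (k % P) (k' % P) (P ^ x) {{m^n≢0 P x}}
      (trans (sym (toℕ-mulFin-base x k)) (trans (cong (λ z → toℕ (proj₁ z)) e) (toℕ-mulFin-base x k'))) ,
    realize-injective s ks ks' (cong proj₂ e)

  realize-isZero : ∀ {r} (s : Vec ℕ r) ks → IsZero (realize s ks) → ks ≈ zeros r
  realize-isZero s ks ks≡0 =
    ≈-trans (realize-injective s ks (scale 0 ks) (trans ks≡0 (realize-pow s ks 0))) (scale-zero 0 ks refl)

  realize-zero : ∀ {r} (s : Vec ℕ r) ks → ks ≈ zeros r → IsZero (realize s ks)
  realize-zero s ks h =
    trans (realize-cong s ks (scale 0 ks) (≈-trans h (≈-sym (scale-zero 0 ks refl)))) (sym (realize-pow s ks 0))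

  socle-cyclic : ∀ x (a : Fin (P ^ suc x)) → mulFin P a ≡ mulFin 0 a → ∃[ k ] a ≡ mulFin k (base x)
  socle-cyclic x a Pa≡0 with m%n≡0⇒n∣m (P * toℕ a) (P ^ suc x) {{m^n≢0 P (suc x)}} Pa%≡0
    where
    Pa%≡0 : _%_ (P * toℕ a) (P ^ suc x) {{m^n≢0 P (suc x)}} ≡ 0
    Pa%≡0 = trans (sym (toℕ-mulFin {{m^n≢0 P (suc x)}} P a))
              (trans (cong toℕ Pa≡0) (trans (toℕ-mulFin {{m^n≢0 P (suc x)}} 0 a) (m<n⇒m%n≡m {{m^n≢0 P (suc x)}} (m^n>0 P (suc x)))))
  ... | divides q Pa≡qPPˣ = q , toℕ-injective (trans a≡qPˣ (sym (trans (toℕ-mulFin-base x q) (cong (_* P ^ x) (m<n⇒m%n≡m q<P)))))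
    where
    swap : ∀ q P B → q * (P * B) ≡ P * (q * B)
    swap = solve-∀
    a≡qPˣ : toℕ a ≡ q * P ^ x
    a≡qPˣ = *-cancelˡ-≡ (toℕ a) (q * P ^ x) P (trans Pa≡qPPˣ (swap q P (P ^ x)))
    q<P : q < P
    q<P = *-cancelʳ-< (P ^ x) q P (subst (_< P * P ^ x) a≡qPˣ (toℕ<n a))

  socle-realized : ∀ {r} (s : Vec ℕ r) (y : Elem (pModuli s)) → IsZero (pow y P) → ∃[ ks ] y ≡ realize s ks
  socle-realized []      tt      _     = [] , refl
  socle-realized (x ∷ s) (a , y) yᴾ≡0 with socle-cyclic x a (trans (cong proj₁ yᴾ≡0) (mulFin-mulFin a P 0))
                                         | socle-realized s y (cong proj₂ yᴾ≡0)
  ... | k , a≡ | ks , y≡ = k ∷ ks , cong₂ _,_ a≡ y≡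

another : ∀ {K} → 2 ≤ K → (i : Fin K) → ∃[ j ] j ≢ i
another (s≤s (s≤s _)) fzero    = fsuc fzero , λ ()
another (s≤s (s≤s _)) (fsuc i) = fzero , λ ()

module Components (p' n' : ℕ) (prime : Prime (suc (suc p'))) {r : ℕ} (s : Vec ℕ r) (2≤r : 2 ≤ r)
                  (P⊥N : Coprime (suc (suc p')) (suc n')) where
  open ProjectiveSpace p' prime
  open Socle p' prime

  N : ℕ
  N = suc n'

  xs : List ℕ
  xs = pModuli s

  open EnhancedPowerGraph (xs ++ (N ∷ []))
  open PGroup prime (exponentOf s) xs (exponent-divides s) using (order-P-in-every-subgroup; order-P-power)

  pPart : G → Elem xs
  pPart = fstE xs

  nPart : G → Elem (N ∷ [])
  nPart = sndE xs

  pPart-∈ : {y w : G} → y ∈⟨ w ⟩ → pPart y ∈⟨ pPart w ⟩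
  pPart-∈ {w = w} (k , refl) = k , fstE-pow xs w k

  crt-power : (x y : G) (a b : ℕ) → pPart y ≡ pow (pPart x) a → nPart y ≡ pow (nPart x) b → y ∈⟨ x ⟩
  crt-power x y a b y₁ y₂ with crt (P ^ exponentOf s) N {{m^n≢0 P (exponentOf s)}} (coprime-^ (exponentOf s) P⊥N) a b
  ... | k , q₁ , q₂ , k≡a , k≡b = k , Elem-ext xs y (pow x k)
    (trans y₁ (sym (trans (fstE-pow xs x k) (trans (cong (pow (pPart x)) k≡a)
      (pow-periodic (P ^ exponentOf s) (exponent-divides s) (pPart x) a q₁)))))
    (trans y₂ (sym (trans (sndE-pow xs x k) (trans (cong (pow (nPart x)) k≡b)
      (pow-periodic N (∣-refl ∷ []) (nPart x) b q₂)))))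

  zeroN : Elem (N ∷ [])
  zeroN = fzero , tt

  generatorN : Elem (N ∷ [])
  generatorN = 1 mod N , tt

  index : Elem (N ∷ []) → ℕ
  index (a , tt) = toℕ a

  generates : (z : Elem (N ∷ [])) → z ≡ pow generatorN (index z)
  generates (a , tt) = cong (_, tt) (toℕ-injective (sym (begin
    toℕ (mulFin (toℕ a) (1 mod N))  ≡⟨ toℕ-mulFin (toℕ a) (1 mod N) ⟩
    (toℕ a * toℕ (1 mod N)) % N     ≡⟨ cong (λ z → (toℕ a * z) % N) (toℕ-fromℕ< _) ⟩
    (toℕ a * (1 % N)) % N           ≡⟨ %-distribˡ-* (toℕ a) (1 % N) N ⟩
    (toℕ a % N * (1 % N % N)) % N   ≡⟨ cong (λ z → (toℕ a % N * z) % N) (m%n%n≡m%n 1 N) ⟩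
    (toℕ a % N * (1 % N)) % N       ≡⟨ %-distribˡ-* (toℕ a) 1 N ⟨
    (toℕ a * 1) % N                 ≡⟨ cong (_% N) (*-identityʳ (toℕ a)) ⟩
    toℕ a % N                       ≡⟨ m<n⇒m%n≡m (toℕ<n a) ⟩
    toℕ a                           ∎)))
    where open ≡-Reasoning

  -- An element with trivial P-part dominates: x and any y are both powers of
  -- w = (P-part of y, generator of Z_N).
  zero-pPart⇒dominating : ∀ x → IsZero (pPart x) → Dominating x
  zero-pPart⇒dominating x x₁≡0 y y≢x = (λ x≡y → y≢x (sym x≡y)) , w ,
    crt-power w x 0 (index (nPart x))
      (trans x₁≡0 (trans (pow-zero (pPart x) (pPart y)) (cong (λ z → pow z 0) (sym w₁))))
      (trans (generates (nPart x)) (cong (λ z → pow z (index (nPart x))) (sym w₂))) ,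
    crt-power w y 1 (index (nPart y))
      (trans (sym (pow-identity (pPart y))) (cong (λ z → pow z 1) (sym w₁)))
      (trans (generates (nPart y)) (cong (λ z → pow z (index (nPart y))) (sym w₂)))
    where
    w : G
    w = joinE xs (pPart y) generatorN
    w₁ : pPart w ≡ pPart y
    w₁ = fstE-join xs (pPart y) generatorN
    w₂ : nPart w ≡ generatorN
    w₂ = sndE-join xs (pPart y) generatorN

  vertex⇒pPart≢0 : ∀ x → Vertex x → ¬ IsZero (pPart x)
  vertex⇒pPart≢0 x x-vertex x₁≡0 = x-vertex (zero-pPart⇒dominating x x₁≡0)

  -- One element per point of the projective space P^(r-1)(F_P): the
  -- normalised socle vector, with N-part 0.
  socleRep : Fin (#points r) → Elem xs
  socleRep i = realize s (point r i)

  rep : Fin (#points r) → G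
  rep i = joinE xs (socleRep i) zeroN

  pPart-rep : ∀ i → pPart (rep i) ≡ socleRep i
  pPart-rep i = fstE-join xs (socleRep i) zeroN

  socleRep-order-P : ∀ i → IsZero (pow (socleRep i) P)
  socleRep-order-P i = subst IsZero (sym (realize-pow s (point r i) P))
    (realize-zero s _ (scale-zero P (point r i) (n%n≡0 P)))

  socleRep-nonzero : ∀ i → ¬ IsZero (socleRep i)
  socleRep-nonzero i rᵢ≡0 = point-nonzero r i (realize-isZero s (point r i) rᵢ≡0)

  socleRep-unique : ∀ {i j} → socleRep i ∈⟨ socleRep j ⟩ → i ≡ j
  socleRep-unique {i} {j} (c , rᵢ≡) =
    sym (point-unique r c j i (realize-injective s _ _ (trans (sym (realize-pow s (point r j) c)) (sym rᵢ≡))))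

  on-some-socleRep : ∀ y → ¬ IsZero y → IsZero (pow y P) → ∃[ i ] y ∈⟨ socleRep i ⟩
  on-some-socleRep y y≢0 yᴾ≡0 with socle-realized s y yᴾ≡0
  ... | ks , refl with on-some-point r ks (λ ks≡0 → y≢0 (realize-zero s ks ks≡0))
  ...   | i , c , ks≡ = i , c , trans (realize-cong s ks _ ks≡) (sym (realize-pow s (point r i) c))

  -- Take y ∈ ⟨pPart x⟩ of
  -- order P, on the line of socleRep i, and a second point j ≠ i.  If x
  -- dominated, x and rep j would lie in a common cyclic group, forcing
  -- y ∈ ⟨socleRep j⟩ and then socleRep j ∈ ⟨y⟩ ⊆ ⟨socleRep i⟩, so j = i.
  pPart≢0⇒vertex : ∀ x → ¬ IsZero (pPart x) → Vertex x
  pPart≢0⇒vertex x x₁≢0 x-dominating with order-P-power (pPart x) x₁≢0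
  ... | y , y∈x , y≢0 , yᴾ≡0 with on-some-socleRep y y≢0 yᴾ≡0
  ...   | i , y∈i with another (two-points r 2≤r) i
  ...     | j , j≢i = j≢i (socleRep-unique (∈⟨⟩-trans rⱼ∈y y∈i))
    where
    y∈j : y ∈⟨ socleRep j ⟩
    y∈j with x ≟E rep j
    ... | yes refl = subst (y ∈⟨_⟩) (pPart-rep j) y∈x
    ... | no x≢rⱼ with x-dominating (rep j) (λ rⱼ≡x → x≢rⱼ (sym rⱼ≡x))
    ...   | _ , w , x∈w , rⱼ∈w = order-P-in-every-subgroup (∈⟨⟩-trans y∈x (pPart-∈ x∈w))
            (subst (_∈⟨ pPart w ⟩) (pPart-rep j) (pPart-∈ rⱼ∈w)) yᴾ≡0 y≢0 (socleRep-nonzero j)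
    rⱼ∈y : socleRep j ∈⟨ y ⟩
    rⱼ∈y = order-P-in-every-subgroup (∈⟨⟩-refl (socleRep j)) y∈j (socleRep-order-P j) (socleRep-nonzero j) y≢0

  rep-vertex : ∀ i → Vertex (rep i)
  rep-vertex i = pPart≢0⇒vertex (rep i) (λ rᵢ≡0 → socleRep-nonzero i (subst IsZero (pPart-rep i) rᵢ≡0))

  socleRep-along-path : ∀ i {v} → Connected (rep i) v → socleRep i ∈⟨ pPart v ⟩
  socleRep-along-path i here = subst (socleRep i ∈⟨_⟩) (sym (pPart-rep i)) (∈⟨⟩-refl (socleRep i))
  socleRep-along-path i (step path w-vertex (_ , g , v∈g , w∈g)) =
    order-P-in-every-subgroup (∈⟨⟩-trans (socleRep-along-path i path) (pPart-∈ v∈g)) (pPart-∈ w∈g)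
      (socleRep-order-P i) (socleRep-nonzero i) (vertex⇒pPart≢0 _ w-vertex)

  separated : ∀ i j → Connected (rep i) (rep j) → i ≡ j
  separated i j path = socleRep-unique (subst (socleRep i ∈⟨_⟩) (pPart-rep j) (socleRep-along-path i path))

  extend : ∀ {a u v} → Connected a u → Vertex v → ∃[ w ] u ∈⟨ w ⟩ × v ∈⟨ w ⟩ → Connected a v
  extend {u = u} {v} path v-vertex common with u ≟E v
  ... | yes refl = path
  ... | no u≢v   = step path v-vertex (u≢v , common)

  -- Every vertex x is joined to ŷ = (y, 0) for some y ∈ ⟨pPart x⟩ of order P,
  -- and ŷ lies in the cyclic group of the representative of the line of y.
  covered : ∀ x → Vertex x → ∃[ i ] Connected x (rep i)
  covered x x-vertex with order-P-power (pPart x) (vertex⇒pPart≢0 x x-vertex)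
  ... | y , (k , y≡xᵏ) , y≢0 , yᴾ≡0 with on-some-socleRep y y≢0 yᴾ≡0
  ...   | i , (c , y≡rᵢᶜ) =
    i , extend (extend here ŷ-vertex (x , ∈⟨⟩-refl x , ŷ∈x)) (rep-vertex i) (rep i , ŷ∈rᵢ , ∈⟨⟩-refl (rep i))
    where
    ŷ : G
    ŷ = joinE xs y zeroN
    ŷ-vertex : Vertex ŷ
    ŷ-vertex = pPart≢0⇒vertex ŷ (λ ŷ₁≡0 → y≢0 (subst IsZero (fstE-join xs y zeroN) ŷ₁≡0))
    ŷ∈x : ŷ ∈⟨ x ⟩
    ŷ∈x = crt-power x ŷ k 0 (trans (fstE-join xs y zeroN) y≡xᵏ) (sndE-join xs y zeroN)
    ŷ∈rᵢ : ŷ ∈⟨ rep i ⟩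
    ŷ∈rᵢ = crt-power (rep i) ŷ c 0
      (trans (fstE-join xs y zeroN) (trans y≡rᵢᶜ (cong (λ z → pow z c) (sym (pPart-rep i)))))
      (sndE-join xs y zeroN)

  components : HasComponents (#points r)
  components = rep , rep-vertex , separated , covered

positive⇒suc-pred : ∀ {r} (t : Vec ℕ r) → (∀ (i : Fin r) → 1 ≤ lookup t i) → t ≡ map suc (map pred t)
positive⇒suc-pred []          pos = refl
positive⇒suc-pred (suc x ∷ t) pos = cong₂ _∷_ refl (positive⇒suc-pred t (λ i → pos (fsuc i)))
positive⇒suc-pred (zero ∷ t)  pos with pos fzero
... | ()

-- The theorem: p = 0, 1 are not prime and n = 0 would give gcd p n = p ≠ 1;
-- otherwise write tᵢ = xᵢ + 1, apply `components` and count the points.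
mainTheorem9 : (p r : ℕ) (t : Vec ℕ r) (n : ℕ) →
    (pp : Prime p) → 2 ≤ r → (∀ (i : Fin r) → 1 ≤ lookup t i) → gcd p n ≡ 1 →
    EnhancedPowerGraph.HasComponents (moduli p t n)
      (_/_ (p ^ r ∸ 1) (p ∸ 1) {{prime⇒pred≢0 pp}})
mainTheorem9 zero           r t n pp 2≤r pos gcd≡1 with () ← prime⇒nonTrivial pp
mainTheorem9 (suc zero)     r t n pp 2≤r pos gcd≡1 with () ← prime⇒nonTrivial pp
mainTheorem9 (suc (suc p')) r t zero pp 2≤r pos gcd≡1
  with () ← gcd≡1⇒coprime gcd≡1 {suc (suc p')} (∣-refl , divides 0 refl)
mainTheorem9 (suc (suc p')) r t (suc n') pp 2≤r pos gcd≡1 =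
  subst₂ (λ t k → EnhancedPowerGraph.HasComponents (moduli (suc (suc p')) t (suc n')) k)
    (sym (positive⇒suc-pred t pos)) (ProjectiveSpace.#points-formula p' pp r)
    (Components.components p' n' pp (map pred t) 2≤r (gcd≡1⇒coprime gcd≡1))
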